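{- Let $K\ge 2$, let $\widetilde{\beta}$ be a length-$L$ necklace on the alphabet $[K]=\{0,\dots,K-1\}$, and let $m$ be an integer with $0 \leq m < L$. Let $\omega$ be a length-$m$ string on $[K]$ and, for $\ell \in [K]$, let $\xi_\ell$ be the length-$(m+1)$ string on $[K]$ $$\xi_\ell = \Big(\ell,\ \ell+\omega[0],\ \ell+\omega[0]+\omega[1],\ \ldots,\ \ell+\textstyle\sum_{j=0}^{m-1}\omega[j]\Big)$$ with arithmetic modulo $K$. Then for each $\ell\in[K]$ and each nonnegative integer $t$: $\omega$ occurs $t$ times as a substring of $\widetilde{\beta}$ if and only if $\xi_\ell$ occurs $t$ times in total as a substring of the necklaces comprising Lempel's lift of $\widetilde{\beta}$. (When $m=0$, $\omega$ is the empty string, which occurs as a substring at every one of the $L$ positions of $\widetilde{\beta}$.)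
   Context: A necklace of length $L$ is a cyclic sequence of $L$ characters; writing $\widetilde{\beta}=(\widetilde{\beta}[0],\dots,\widetilde{\beta}[L-1])$, indices are taken modulo $L$. The number of occurrences of a length-$m$ string $\omega$ ($m\le$ necklace length) as a substring of a necklace $\widetilde{\gamma}$ of length $n$ is the number of $i\in\{0,\dots,n-1\}$ with $\widetilde{\gamma}[i+t]=\omega[t]$ for all $t<m$; the number of occurrences in a family of necklaces is the sum over its members. Characters in $[K]$ are added modulo $K$, and adding an integer to a necklace adds it to every character. Lempel's lift of $\widetilde{\beta}$: let $d$ be the smallest positive integer such that $d\cdot\sum_{j=0}^{L-1}\widetilde{\beta}[j]$ is divisible by $K$, and $p=K/d$. Lempel's lift is the family of necklaces $\{\widetilde{\lambda}_i : i \in \{0,\dots,p-1\}\}$ on $[K]$, each of length $dL$, given by $$\widetilde{\lambda}_i = i + \Big(\widetilde{\beta}[0],\ \widetilde{\beta}[0]+\widetilde{\beta}[1],\ \ldots,\ \textstyle\sum_{j=0}^{dL-1}\widetilde{\beta}[j]\Big)$$ (a cyclic sequence, arithmetic modulo $K$, indices of $\widetilde{\beta}$ modulo $L$). -}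

module Defs where

open import Data.Nat using (ℕ; zero; suc; _+_; _*_; _<_; NonZero)
open import Data.Nat.Divisibility using (_∣_)
open import Data.Nat.Properties using (m*n≢0)
open import Data.Nat.DivMod using (_%_; _/_)
open import Data.Product using (_×_)
import Relation.Nullary
open import Data.Fin using (Fin; toℕ; fromℕ<)
open import Data.Nat.DivMod using (m%n<n)
open import Data.Bool using (Bool; true; false; _∧_; if_then_else_)
open import Data.Fin.Properties using () renaming (_≟_ to _≟ᶠ_)
open import Relation.Nullary.Decidable using (⌊_⌋)

-- Characters are elements of Fin K; a necklace of length n is a map
-- Fin n → Fin K (indices read modulo n); a string of length m is Fin m → Fin K.

_⊕_ : {K : ℕ} .{{_ : NonZero K}} → Fin K → Fin K → Fin K
_⊕_ {K} a b = fromℕ< (m%n<n (toℕ a + toℕ b) K)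

_[_] : {K n : ℕ} .{{_ : NonZero n}} → (Fin n → Fin K) → ℕ → Fin K
_[_] {n = n} γ i = γ (fromℕ< (m%n<n i n))

zeroF : {K : ℕ} .{{_ : NonZero K}} → Fin K
zeroF {suc K} = Data.Fin.zero

sumMod : {K : ℕ} .{{_ : NonZero K}} → (ℕ → Fin K) → ℕ → Fin K
sumMod f zero = zeroF
sumMod f (suc n) = sumMod f n ⊕ f n

sumℕ : (ℕ → ℕ) → ℕ → ℕ
sumℕ f zero = 0
sumℕ f (suc n) = sumℕ f n + f n

count : ℕ → (ℕ → Bool) → ℕ
count zero P = 0
count (suc n) P = count n P + (if P n then 1 else 0)

occursAt : {K n : ℕ} .{{_ : NonZero n}} → (Fin n → Fin K) →
           (m : ℕ) → (Fin m → Fin K) → ℕ → Bool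
occursAt γ zero ω i = true
occursAt γ (suc m) ω i =
  ⌊ γ [ i + toℕ (Data.Fin.fromℕ m) ] ≟ᶠ ω (Data.Fin.fromℕ m) ⌋
    ∧ occursAt γ m (λ t → ω (Data.Fin.inject₁ t)) i

occurrences : {K n : ℕ} .{{_ : NonZero n}} → (Fin n → Fin K) →
              (m : ℕ) → (Fin m → Fin K) → ℕ
occurrences {n = n} γ m ω = count n (occursAt γ m ω)

-- Occurrences in a necklace of length n given as a cyclic function on ℕ
-- (g must only be read at indices < n; we read g (i + t) reduced modulo n).
occurrencesℕ : {K : ℕ} (n : ℕ) .{{_ : NonZero n}} → (ℕ → Fin K) →
               (m : ℕ) → (Fin m → Fin K) → ℕ
occurrencesℕ n g m ω = occurrences {n = n} (λ j → g (toℕ j)) m ω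

charSum : {K L : ℕ} → (Fin L → Fin K) → ℕ
charSum {L = L} β = sumℕ (λ j → toℕ-or0 j) L
  where
  toℕ-or0 : ℕ → ℕ
  toℕ-or0 j with Data.Nat._<?_ j L
  ... | Relation.Nullary.yes j<L = toℕ (β (fromℕ< j<L))
  ... | Relation.Nullary.no _ = 0

IsLempelPeriod : {K L : ℕ} → (Fin L → Fin K) → ℕ → Set
IsLempelPeriod {K} β d =
  (0 < d) × (K ∣ d * charSum β) × (∀ d′ → 0 < d′ → K ∣ d′ * charSum β → d Data.Nat.≤ d′)

-- the i-th member of Lempel's lift, as a function of the position j ∈ [0, dL):
-- λ_i[j] = i + Σ_{k=0}^{j} β[k mod L]   (mod K)
liftMember : {K L : ℕ} .{{_ : NonZero K}} .{{_ : NonZero L}} →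
             (Fin L → Fin K) → Fin K → ℕ → Fin K
liftMember β i j = i ⊕ sumMod (λ k → β [ k ]) (suc j)

-- total number of occurrences of ξ (length m) in Lempel's lift of β,
-- given d (the Lempel period, positive) : sum over i < p = K / d of the
-- occurrences in λ_i, a necklace of length d·L
liftOccurrences : {K L : ℕ} .{{_ : NonZero K}} .{{_ : NonZero L}} →
                  (β : Fin L → Fin K) → (d : ℕ) .{{_ : NonZero d}} →
                  (m : ℕ) → (Fin m → Fin K) → ℕ
liftOccurrences {K} {L} β d m ξ = go (K / d)
  where
  instance
    nzdL : NonZero (d * L)
    nzdL = m*n≢0 d L
  go : ℕ → ℕ
  go zero = 0
  go (suc i) = go i + occurrencesℕ (d * L) (liftMember β (fromℕ< (m%n<n i K))) m ξ

xiString : {K : ℕ} .{{_ : NonZero K}} → (m : ℕ) → (Fin m → Fin K) →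
           Fin K → Fin (suc m) → Fin K
xiString {K} m ω ℓ t = ℓ ⊕ sumMod ωℕ (toℕ t)
  where
  ωℕ : ℕ → Fin K
  ωℕ j with Data.Nat._<?_ j m
  ... | Relation.Nullary.yes j<m = ω (fromℕ< j<m)
  ... | Relation.Nullary.no _ = zeroF

-- Write Σ(n) for the sum of the first n characters of β and c = Σ(L). The i-th member of the
-- lift is λᵢ[x] = i + Σ(x + 1) mod K, of period dL because K ∣ d·c. Consecutive characters of
-- ξ_ℓ differ by the characters of ω, and those of λᵢ by the characters of β, so ξ_ℓ occurs in λᵢ
-- at s exactly when ω occurs in β at s + 1 and i + Σ(s + 1) ≡ ℓ (mod K). Writing s + 1 = qL + r,
-- the second condition reads i + q·c + Σ(r) ≡ ℓ; minimality of d makes (i, q) ↦ i + q·c a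
-- bijection from [0, K/d) × [0, d) onto the residues mod K, so every occurrence of ω in β is
-- counted exactly once in the lift.

module Submission where

open import Algebra.Properties.CommutativeSemigroup using (interchange)
open import Data.Bool using (Bool; true; false; _∧_; if_then_else_; T)
open import Data.Bool.Properties using (T-≡; T-∧; ⇔→≡)
open import Data.Empty using (⊥-elim)
open import Data.Fin using (Fin; toℕ; fromℕ<; fromℕ; inject₁)
open import Data.Fin.Properties
  using (toℕ-fromℕ<; toℕ-fromℕ; toℕ-inject₁; toℕ-injective; toℕ<n; fromℕ<-cong; fromℕ<-toℕ)
  renaming (_≟_ to _≟ᶠ_)
open import Data.Nat
open import Data.Nat.DivMod
open import Data.Nat.Divisibility
open import Data.Nat.Properties
open import Data.Nat.Tactic.RingSolver using (solve-∀)
open import Data.Product using (_×_; _,_)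
open import Data.Product.Function.NonDependent.Propositional using (_×-⇔_)
open import Data.Sum using (inj₁; inj₂)
open import Function.Bundles using (_⇔_; mk⇔; Equivalence)
open import Function.Properties.Equivalence using () renaming (sym to ⇔-sym; trans to ⇔-trans)
open import Relation.Binary.PropositionalEquality hiding ([_])
open import Relation.Nullary using (yes; no; ¬_)
open import Relation.Nullary.Decidable using (⌊_⌋; toWitness; fromWitness)

open import Defs

sumℕ-cong : ∀ n {f g : ℕ → ℕ} → (∀ k → k < n → f k ≡ g k) → sumℕ f n ≡ sumℕ g n
sumℕ-cong zero    f≗g = refl
sumℕ-cong (suc n) f≗g = cong₂ _+_ (sumℕ-cong n (λ k k<n → f≗g k (m<n⇒m<1+n k<n))) (f≗g n ≤-refl)

sumℕ-mono-≤ : ∀ n {f g : ℕ → ℕ} → (∀ k → k < n → f k ≤ g k) → sumℕ f n ≤ sumℕ g n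
sumℕ-mono-≤ zero    f≤g = z≤n
sumℕ-mono-≤ (suc n) f≤g = +-mono-≤ (sumℕ-mono-≤ n (λ k k<n → f≤g k (m<n⇒m<1+n k<n))) (f≤g n ≤-refl)

sumℕ-mono-< : ∀ n {f g : ℕ → ℕ} → (∀ k → k < n → f k ≤ g k) →
              ∀ {x} → x < n → f x < g x → sumℕ f n < sumℕ g n
sumℕ-mono-< (suc n) f≤g {x} x<1+n fx<gx with x ≟ n
... | yes refl = +-mono-≤-< (sumℕ-mono-≤ n (λ k k<n → f≤g k (m<n⇒m<1+n k<n))) fx<gx
... | no x≢n   = +-mono-<-≤ (sumℕ-mono-< n (λ k k<n → f≤g k (m<n⇒m<1+n k<n)) x<n fx<gx) (f≤g n ≤-refl)
  where
  x<n : x < n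
  x<n = ≤∧≢⇒< (s≤s⁻¹ x<1+n) x≢n

sumℕ-const : ∀ n x → sumℕ (λ _ → x) n ≡ n * x
sumℕ-const zero    x = refl
sumℕ-const (suc n) x = trans (cong (_+ x) (sumℕ-const n x)) (+-comm (n * x) x)

sumℕ-distrib-+ : ∀ n (f g : ℕ → ℕ) → sumℕ (λ k → f k + g k) n ≡ sumℕ f n + sumℕ g n
sumℕ-distrib-+ zero    f g = refl
sumℕ-distrib-+ (suc n) f g =
  trans (cong (_+ (f n + g n)) (sumℕ-distrib-+ n f g)) (interchange +-commutativeSemigroup (sumℕ f n) (sumℕ g n) (f n) (g n))

sumℕ-distribˡ-* : ∀ n c (f : ℕ → ℕ) → sumℕ (λ k → c * f k) n ≡ c * sumℕ f n
sumℕ-distribˡ-* zero    c f = sym (*-zeroʳ c)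
sumℕ-distribˡ-* (suc n) c f =
  trans (cong (_+ c * f n) (sumℕ-distribˡ-* n c f)) (sym (*-distribˡ-+ c (sumℕ f n) (f n)))

sumℕ-comm : ∀ a b (f : ℕ → ℕ → ℕ) →
            sumℕ (λ i → sumℕ (f i) b) a ≡ sumℕ (λ j → sumℕ (λ i → f i j) a) b
sumℕ-comm zero    b f = sym (trans (sumℕ-const b 0) (*-zeroʳ b))
sumℕ-comm (suc a) b f =
  trans (cong (_+ sumℕ (f a) b) (sumℕ-comm a b f)) (sym (sumℕ-distrib-+ b (λ j → sumℕ (λ i → f i j) a) (f a)))

sumℕ-+ : ∀ a b (f : ℕ → ℕ) → sumℕ f (a + b) ≡ sumℕ f a + sumℕ (λ k → f (a + k)) b
sumℕ-+ a zero    f = trans (cong (sumℕ f) (+-identityʳ a)) (sym (+-identityʳ (sumℕ f a)))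
sumℕ-+ a (suc b) f =
  trans (cong (sumℕ f) (+-suc a b)) (trans (cong (_+ f (a + b)) (sumℕ-+ a b f)) (+-assoc (sumℕ f a) _ _))

sumℕ-* : ∀ q n (f : ℕ → ℕ) → sumℕ f (q * n) ≡ sumℕ (λ i → sumℕ (λ r → f (i * n + r)) n) q
sumℕ-* zero    n f = refl
sumℕ-* (suc q) n f =
  trans (cong (sumℕ f) (+-comm n (q * n)))
        (trans (sumℕ-+ (q * n) n f) (cong (_+ sumℕ (λ r → f (q * n + r)) n) (sumℕ-* q n f)))

sumℕ-factor : ∀ a b n (g : ℕ → ℕ) (e : ℕ → ℕ → ℕ → ℕ) →
              sumℕ (λ i → sumℕ (λ q → sumℕ (λ r → g r * e i q r) n) b) a ≡
              sumℕ (λ r → g r * sumℕ (λ i → sumℕ (λ q → e i q r) b) a) n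
sumℕ-factor a b n g e = begin
  sumℕ (λ i → sumℕ (λ q → sumℕ (λ r → g r * e i q r) n) b) a
    ≡⟨ sumℕ-cong a (λ i _ → sumℕ-comm b n (λ q r → g r * e i q r)) ⟩
  sumℕ (λ i → sumℕ (λ r → sumℕ (λ q → g r * e i q r) b) n) a
    ≡⟨ sumℕ-comm a n (λ i r → sumℕ (λ q → g r * e i q r) b) ⟩
  sumℕ (λ r → sumℕ (λ i → sumℕ (λ q → g r * e i q r) b) a) n
    ≡⟨ sumℕ-cong n (λ r _ → sumℕ-cong a (λ i _ → sumℕ-distribˡ-* b (g r) (λ q → e i q r))) ⟩
  sumℕ (λ r → sumℕ (λ i → g r * sumℕ (λ q → e i q r) b) a) n
    ≡⟨ sumℕ-cong n (λ r _ → sumℕ-distribˡ-* a (g r) (λ i → sumℕ (λ q → e i q r) b)) ⟩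
  sumℕ (λ r → g r * sumℕ (λ i → sumℕ (λ q → e i q r) b) a) n
    ∎
  where open ≡-Reasoning

sumℕ-rotate : ∀ n (f : ℕ → ℕ) → f n ≡ f 0 → sumℕ (λ k → f (suc k)) n ≡ sumℕ f n
sumℕ-rotate n f fn≡f0 = +-cancelˡ-≡ (f 0) _ _ (begin
  f 0 + sumℕ (λ k → f (suc k)) n ≡⟨ sumℕ-+ 1 n f ⟨
  sumℕ f n + f n                 ≡⟨ cong (sumℕ f n +_) fn≡f0 ⟩
  sumℕ f n + f 0                 ≡⟨ +-comm (sumℕ f n) (f 0) ⟩
  f 0 + sumℕ f n                 ∎)
  where open ≡-Reasoning

sumℕ-recursion : ∀ {g f : ℕ → ℕ} → g 0 ≡ 0 → (∀ n → g (suc n) ≡ g n + f n) → ∀ n → g n ≡ sumℕ f n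
sumℕ-recursion g0≡0 gsuc zero    = g0≡0
sumℕ-recursion g0≡0 gsuc (suc n) = trans (gsuc n) (cong (_+ _) (sumℕ-recursion g0≡0 gsuc n))

indicator : Bool → ℕ
indicator b = if b then 1 else 0

indicator-T : ∀ {b} → T b → indicator b ≡ 1
indicator-T {true} _ = refl

indicator-∧ : ∀ a b → indicator (a ∧ b) ≡ indicator a * indicator b
indicator-∧ true  b = sym (+-identityʳ (indicator b))
indicator-∧ false b = refl

count≡sumℕ : ∀ n P → count n P ≡ sumℕ (λ k → indicator (P k)) n
count≡sumℕ zero    P = refl
count≡sumℕ (suc n) P = cong (_+ indicator (P n)) (count≡sumℕ n P)

count-none : ∀ n (P : ℕ → Bool) → (∀ k → k < n → ¬ T (P k)) → count n P ≡ 0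
count-none zero    P none = refl
count-none (suc n) P none with P n in Pn
... | true  = ⊥-elim (none n ≤-refl (subst T (sym Pn) _))
... | false = trans (+-identityʳ (count n P)) (count-none n P (λ k k<n → none k (m<n⇒m<1+n k<n)))

count-≤1 : ∀ n (P : ℕ → Bool) → (∀ a b → a < n → b < n → T (P a) → T (P b) → a ≡ b) → count n P ≤ 1
count-≤1 zero    P unique = z≤n
count-≤1 (suc n) P unique with P n in Pn
... | true  = ≤-reflexive (cong (_+ 1) (count-none n P (λ k k<n Pk →
                <-irrefl (unique k n (m<n⇒m<1+n k<n) ≤-refl Pk (subst T (sym Pn) _)) k<n)))
... | false = subst (_≤ 1) (sym (+-identityʳ (count n P)))
                (count-≤1 n P (λ a b a<n b<n → unique a b (m<n⇒m<1+n a<n) (m<n⇒m<1+n b<n)))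

count-≥1 : ∀ n (P : ℕ → Bool) {y} → y < n → T (P y) → 1 ≤ count n P
count-≥1 (suc n) P {y} y<1+n Py with y ≟ n
... | yes refl = ≤-trans (≤-reflexive (sym (indicator-T Py))) (m≤n+m (indicator (P y)) (count y P))
... | no y≢n   = ≤-trans (count-≥1 n P (≤∧≢⇒< (s≤s⁻¹ y<1+n) y≢n) Py) (m≤m+n (count n P) _)

count-injective-hits : ∀ N (f : ℕ → ℕ) → (∀ n → n < N → f n < N) →
                       (∀ a b → a < N → b < N → f a ≡ f b → a ≡ b) →
                       ∀ x → x < N → count N (λ n → f n ≡ᵇ x) ≡ 1
count-injective-hits N f f<N injective x x<N =
  ≤-antisym (hits≤1 x) (≮⇒≥ λ hits<1 → <-irrefl total (begin-strict
    sumℕ hits N           <⟨ sumℕ-mono-< N (λ y _ → hits≤1 y) x<N hits<1 ⟩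
    sumℕ (λ _ → 1) N      ≡⟨ sumℕ-const N 1 ⟩
    N * 1                 ≡⟨ *-identityʳ N ⟩
    N                     ∎))
  where
  hits : ℕ → ℕ
  hits y = count N (λ n → f n ≡ᵇ y)

  hits≤1 : ∀ y → hits y ≤ 1
  hits≤1 y = count-≤1 N _ (λ a b a<N b<N fa≡y fb≡y →
    injective a b a<N b<N (trans (≡ᵇ⇒≡ (f a) y fa≡y) (sym (≡ᵇ⇒≡ (f b) y fb≡y))))

  hit-once : ∀ n → n < N → count N (λ y → f n ≡ᵇ y) ≡ 1
  hit-once n n<N = ≤-antisym
    (count-≤1 N _ (λ a b _ _ fn≡a fn≡b → trans (sym (≡ᵇ⇒≡ (f n) a fn≡a)) (≡ᵇ⇒≡ (f n) b fn≡b)))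
    (count-≥1 N _ (f<N n n<N) (≡⇒≡ᵇ (f n) (f n) refl))

  total : sumℕ hits N ≡ N
  total = begin
    sumℕ hits N
      ≡⟨ sumℕ-cong N (λ y _ → count≡sumℕ N _) ⟩
    sumℕ (λ y → sumℕ (λ n → indicator (f n ≡ᵇ y)) N) N
      ≡⟨ sumℕ-comm N N (λ y n → indicator (f n ≡ᵇ y)) ⟩
    sumℕ (λ n → sumℕ (λ y → indicator (f n ≡ᵇ y)) N) N
      ≡⟨ sumℕ-cong N (λ n n<N → trans (sym (count≡sumℕ N _)) (hit-once n n<N)) ⟩
    sumℕ (λ _ → 1) N
      ≡⟨ sumℕ-const N 1 ⟩
    N * 1
      ≡⟨ *-identityʳ N ⟩
    N                                                      ∎
    where open ≡-Reasoning
  open ≤-Reasoning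

[m%n+o]%n≡[m+o]%n : ∀ m o n .{{_ : NonZero n}} → (m % n + o) % n ≡ (m + o) % n
[m%n+o]%n≡[m+o]%n m o n = begin
  (m % n + o) % n         ≡⟨ %-distribˡ-+ (m % n) o n ⟩
  (m % n % n + o % n) % n ≡⟨ cong (λ x → (x + o % n) % n) (m%n%n≡m%n m n) ⟩
  (m % n + o % n) % n     ≡⟨ %-distribˡ-+ m o n ⟨
  (m + o) % n             ∎
  where open ≡-Reasoning

[m+o%n]%n≡[m+o]%n : ∀ m o n .{{_ : NonZero n}} → (m + o % n) % n ≡ (m + o) % n
[m+o%n]%n≡[m+o]%n m o n = begin
  (m + o % n) % n ≡⟨ cong (_% n) (+-comm m (o % n)) ⟩
  (o % n + m) % n ≡⟨ [m%n+o]%n≡[m+o]%n o m n ⟩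
  (o + m) % n     ≡⟨ cong (_% n) (+-comm o m) ⟩
  (m + o) % n     ∎
  where open ≡-Reasoning

%-cong-+ʳ : ∀ m o k n .{{_ : NonZero n}} → m % n ≡ o % n → (m + k) % n ≡ (o + k) % n
%-cong-+ʳ m o k n m≡o = begin
  (m + k) % n     ≡⟨ [m%n+o]%n≡[m+o]%n m k n ⟨
  (m % n + k) % n ≡⟨ cong (λ x → (x + k) % n) m≡o ⟩
  (o % n + k) % n ≡⟨ [m%n+o]%n≡[m+o]%n o k n ⟩
  (o + k) % n     ∎
  where open ≡-Reasoning

%-cong-+ˡ : ∀ k m o n .{{_ : NonZero n}} → m % n ≡ o % n → (k + m) % n ≡ (k + o) % n
%-cong-+ˡ k m o n m≡o = begin
  (k + m) % n ≡⟨ cong (_% n) (+-comm k m) ⟩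
  (m + k) % n ≡⟨ %-cong-+ʳ m o k n m≡o ⟩
  (o + k) % n ≡⟨ cong (_% n) (+-comm o k) ⟩
  (k + o) % n ∎
  where open ≡-Reasoning

%-cancel-+ˡ : ∀ k m o n .{{_ : NonZero n}} → (k + m) % n ≡ (k + o) % n → m % n ≡ o % n
%-cancel-+ˡ k m o n@(suc j) k+m≡k+o = begin
  m % n               ≡⟨ [m+kn]%n≡m%n m k n ⟨
  (m + k * n) % n     ≡⟨ cong (_% n) (shift-to-multiple m) ⟩
  (k + m + k * j) % n ≡⟨ %-cong-+ʳ (k + m) (k + o) (k * j) n k+m≡k+o ⟩
  (k + o + k * j) % n ≡⟨ cong (_% n) (shift-to-multiple o) ⟨
  (o + k * n) % n     ≡⟨ [m+kn]%n≡m%n o k n ⟩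
  o % n               ∎
  where
  open ≡-Reasoning
  -- adding k·(n − 1) to k + x turns the offset k into the multiple k·n
  shift-to-multiple : ∀ x → x + k * suc j ≡ k + x + k * j
  shift-to-multiple x = trans (cong (x +_) (*-suc k j)) (trans (sym (+-assoc x k (k * j))) (cong (_+ k * j) (+-comm x k)))

%≡%⇒∣∸ : ∀ {m o} n .{{_ : NonZero n}} → m % n ≡ o % n → m ≤ o → n ∣ o ∸ m
%≡%⇒∣∸ {m} {o} n@(suc _) m≡o m≤o = m%n≡0⇒n∣m (o ∸ m) n (%-cancel-+ˡ m (o ∸ m) 0 n (begin
  (m + (o ∸ m)) % n ≡⟨ cong (_% n) (m+[n∸m]≡n m≤o) ⟩
  o % n             ≡⟨ m≡o ⟨
  m % n             ≡⟨ cong (_% n) (+-identityʳ m) ⟨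
  (m + 0) % n       ∎))
  where open ≡-Reasoning

running-sums-≡-mod⇔ : ∀ {K} .{{_ : NonZero K}} a b (x y : ℕ → ℕ) m →
  (∀ u → x u < K) → (∀ u → y u < K) →
  (∀ u → u ≤ m → (a + sumℕ x u) % K ≡ (b + sumℕ y u) % K) ⇔
  (a % K ≡ b % K × (∀ u → u < m → x u ≡ y u))
running-sums-≡-mod⇔ {K} a b x y m x<K y<K = mk⇔ to from
  where
  open ≡-Reasoning
  A B : ℕ → ℕ
  A u = a + sumℕ x u
  B u = b + sumℕ y u

  +-identityʳ-% : ∀ c → (c + 0) % K ≡ c % K
  +-identityʳ-% c = cong (_% K) (+-identityʳ c)

  to : (∀ u → u ≤ m → A u % K ≡ B u % K) → a % K ≡ b % K × (∀ u → u < m → x u ≡ y u)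
  to A≡B = trans (sym (+-identityʳ-% a)) (trans (A≡B 0 z≤n) (+-identityʳ-% b)) , x≡y
    where
    x≡y : ∀ u → u < m → x u ≡ y u
    x≡y u u<m = begin
      x u         ≡⟨ m<n⇒m%n≡m (x<K u) ⟨
      x u % K     ≡⟨ %-cancel-+ˡ (B u) (x u) (y u) K (begin
        (B u + x u) % K ≡⟨ %-cong-+ʳ (A u) (B u) (x u) K (A≡B u (<⇒≤ u<m)) ⟨
        (A u + x u) % K ≡⟨ cong (_% K) (+-assoc a (sumℕ x u) (x u)) ⟩
        A (suc u) % K   ≡⟨ A≡B (suc u) u<m ⟩
        B (suc u) % K   ≡⟨ cong (_% K) (+-assoc b (sumℕ y u) (y u)) ⟨
        (B u + y u) % K ∎) ⟩
      y u % K     ≡⟨ m<n⇒m%n≡m (y<K u) ⟩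
      y u         ∎

  from : a % K ≡ b % K × (∀ u → u < m → x u ≡ y u) → ∀ u → u ≤ m → A u % K ≡ B u % K
  from (a≡b , x≡y) zero    _   = trans (+-identityʳ-% a) (trans a≡b (sym (+-identityʳ-% b)))
  from (a≡b , x≡y) (suc u) u<m = begin
    A (suc u) % K   ≡⟨ cong (_% K) (+-assoc a (sumℕ x u) (x u)) ⟨
    (A u + x u) % K ≡⟨ %-cong-+ʳ (A u) (B u) (x u) K (from (a≡b , x≡y) u (<⇒≤ u<m)) ⟩
    (B u + x u) % K ≡⟨ cong (λ z → (B u + z) % K) (x≡y u u<m) ⟩
    (B u + y u) % K ≡⟨ cong (_% K) (+-assoc b (sumℕ y u) (y u)) ⟩
    B (suc u) % K   ∎

T⇔T⇒≡ : ∀ {x y} → T x ⇔ T y → x ≡ y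
T⇔T⇒≡ Tx⇔Ty = ⇔→≡ (⇔-trans (⇔-sym T-≡) (⇔-trans Tx⇔Ty T-≡))

≡-fromℕ< : ∀ {n u} (t : Fin n) .(u<n : u < n) → toℕ t ≡ u → t ≡ fromℕ< u<n
≡-fromℕ< t u<n t≡u = trans (sym (fromℕ<-toℕ t (toℕ<n t))) (fromℕ<-cong _ _ t≡u (toℕ<n t) u<n)

toℕ-⊕ : ∀ {K} .{{_ : NonZero K}} (a b : Fin K) → toℕ (a ⊕ b) ≡ (toℕ a + toℕ b) % K
toℕ-⊕ a b = toℕ-fromℕ< _

toℕ-zeroF : ∀ {K} .{{_ : NonZero K}} → toℕ (zeroF {K}) ≡ 0
toℕ-zeroF {suc K} = refl

toℕ-sumMod : ∀ {K} .{{_ : NonZero K}} (F : ℕ → Fin K) n → toℕ (sumMod F n) ≡ sumℕ (λ j → toℕ (F j)) n % K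
toℕ-sumMod {suc K} F zero    = refl
toℕ-sumMod {K}     F (suc n) = begin
  toℕ (sumMod F n ⊕ F n)                            ≡⟨ toℕ-⊕ (sumMod F n) (F n) ⟩
  (toℕ (sumMod F n) + toℕ (F n)) % K                ≡⟨ cong (λ x → (x + toℕ (F n)) % K) (toℕ-sumMod F n) ⟩
  (sumℕ (λ j → toℕ (F j)) n % K + toℕ (F n)) % K    ≡⟨ [m%n+o]%n≡[m+o]%n _ (toℕ (F n)) K ⟩
  sumℕ (λ j → toℕ (F j)) (suc n) % K                ∎
  where open ≡-Reasoning

[]-cong-% : ∀ {K n} .{{_ : NonZero n}} (γ : Fin n → Fin K) {i j} → i % n ≡ j % n → γ [ i ] ≡ γ [ j ]
[]-cong-% γ i≡j = cong γ (fromℕ<-cong _ _ i≡j _ _)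

[]-< : ∀ {K n} .{{_ : NonZero n}} (γ : Fin n → Fin K) {i} (i<n : i < n) → γ [ i ] ≡ γ (fromℕ< i<n)
[]-< γ i<n = cong γ (fromℕ<-cong _ _ (m<n⇒m%n≡m i<n) _ i<n)

occursAt⇔ : ∀ {K n} .{{_ : NonZero n}} (γ : Fin n → Fin K) m (ω : Fin m → Fin K) i →
            T (occursAt γ m ω i) ⇔ (∀ u (u<m : u < m) → γ [ i + u ] ≡ ω (fromℕ< u<m))
occursAt⇔ γ zero    ω i = mk⇔ (λ _ u ()) (λ _ → _)
occursAt⇔ γ (suc m) ω i = mk⇔ to from
  where
  IH : T (occursAt γ m (λ t → ω (inject₁ t)) i) ⇔ (∀ u (u<m : u < m) → γ [ i + u ] ≡ ω (inject₁ (fromℕ< u<m)))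
  IH = occursAt⇔ γ m (λ t → ω (inject₁ t)) i

  inject₁-fromℕ< : ∀ {u} (u<m : u < m) (u<1+m : u < suc m) → inject₁ (fromℕ< u<m) ≡ fromℕ< u<1+m
  inject₁-fromℕ< u<m u<1+m = ≡-fromℕ< _ u<1+m (trans (toℕ-inject₁ _) (toℕ-fromℕ< u<m))

  to : T (occursAt γ (suc m) ω i) → ∀ u (u<1+m : u < suc m) → γ [ i + u ] ≡ ω (fromℕ< u<1+m)
  to h u u<1+m with Equivalence.to T-∧ h | u ≟ m
  ... | last , _    | yes refl = trans (cong (λ z → γ [ i + z ]) (sym (toℕ-fromℕ u)))
                                   (trans (toWitness last) (cong ω (≡-fromℕ< (fromℕ u) u<1+m (toℕ-fromℕ u))))
  ... | _    , rest | no u≢m   = trans (Equivalence.to IH rest u u<m) (cong ω (inject₁-fromℕ< u<m u<1+m))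
    where
    u<m : u < m
    u<m = ≤∧≢⇒< (s≤s⁻¹ u<1+m) u≢m

  from : (∀ u (u<1+m : u < suc m) → γ [ i + u ] ≡ ω (fromℕ< u<1+m)) → T (occursAt γ (suc m) ω i)
  from h = Equivalence.from T-∧
    ( fromWitness (trans (cong (λ z → γ [ i + z ]) (toℕ-fromℕ m))
                         (trans (h m ≤-refl) (cong ω (sym (≡-fromℕ< (fromℕ m) ≤-refl (toℕ-fromℕ m))))))
    , Equivalence.from IH (λ u u<m → trans (h u (m<n⇒m<1+n u<m)) (cong ω (sym (inject₁-fromℕ< u<m (m<n⇒m<1+n u<m))))))

occursAt-cong-% : ∀ {K n} .{{_ : NonZero n}} (γ : Fin n → Fin K) m ω {i j} →
                  i % n ≡ j % n → occursAt γ m ω i ≡ occursAt γ m ω j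
occursAt-cong-% γ zero    ω i≡j = refl
occursAt-cong-% {n = n} γ (suc m) ω {i} {j} i≡j =
  cong₂ (λ a b → ⌊ a ≟ᶠ ω (fromℕ m) ⌋ ∧ b)
        ([]-cong-% γ (%-cong-+ʳ i j (toℕ (fromℕ m)) n i≡j)) (occursAt-cong-% γ m (λ t → ω (inject₁ t)) i≡j)

-- charSum and xiString sum a function local to their definitions, which cannot be named
-- here; unifying g a with the unfolded definition recovers it.
argument : ∀ {A B : Set} (g : A → B) {a : A} {b : B} → g a ≡ b → A
argument g {a} _ = a

stringDigit : ∀ {K m} → (Fin m → Fin K) → ℕ → ℕ
stringDigit {m = m} ω u with u <? m
... | yes u<m = toℕ (ω (fromℕ< u<m))
... | no _    = 0

stringDigit<K : ∀ {K m} .{{_ : NonZero K}} (ω : Fin m → Fin K) u → stringDigit ω u < K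
stringDigit<K {K} {m} ω u with u <? m
... | yes u<m = toℕ<n (ω (fromℕ< u<m))
... | no _    = >-nonZero⁻¹ K

stringDigit-< : ∀ {K m} (ω : Fin m → Fin K) {u} (u<m : u < m) → stringDigit ω u ≡ toℕ (ω (fromℕ< u<m))
stringDigit-< {m = m} ω {u} u<m with u <? m
... | yes _   = refl
... | no u≮m = ⊥-elim (u≮m u<m)

xiSummand : ∀ {K} .{{_ : NonZero K}} m (ω : Fin m → Fin K) ℓ (t : Fin (suc m)) → ℕ → Fin K
xiSummand m ω ℓ t = argument (λ F → ℓ ⊕ sumMod F (toℕ t)) (refl {x = xiString m ω ℓ t})

toℕ-xiSummand : ∀ {K} .{{_ : NonZero K}} m (ω : Fin m → Fin K) ℓ t j → toℕ (xiSummand m ω ℓ t j) ≡ stringDigit ω j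
toℕ-xiSummand m ω ℓ t j with j <? m
... | yes _ = refl
... | no _  = toℕ-zeroF

toℕ-xiString : ∀ {K} .{{_ : NonZero K}} m (ω : Fin m → Fin K) ℓ t →
               toℕ (xiString m ω ℓ t) ≡ (toℕ ℓ + sumℕ (stringDigit ω) (toℕ t)) % K
toℕ-xiString {K} m ω ℓ t = begin
  toℕ (ℓ ⊕ sumMod F (toℕ t))
    ≡⟨ toℕ-⊕ ℓ (sumMod F (toℕ t)) ⟩
  (toℕ ℓ + toℕ (sumMod F (toℕ t))) % K
    ≡⟨ cong (λ x → (toℕ ℓ + x) % K) (toℕ-sumMod F (toℕ t)) ⟩
  (toℕ ℓ + sumℕ (λ j → toℕ (F j)) (toℕ t) % K) % K
    ≡⟨ [m+o%n]%n≡[m+o]%n (toℕ ℓ) _ K ⟩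
  (toℕ ℓ + sumℕ (λ j → toℕ (F j)) (toℕ t)) % K
    ≡⟨ cong (λ x → (toℕ ℓ + x) % K) (sumℕ-cong (toℕ t) (λ j _ → toℕ-xiSummand m ω ℓ t j)) ⟩
  (toℕ ℓ + sumℕ (stringDigit ω) (toℕ t)) % K          ∎
  where
  open ≡-Reasoning
  F : ℕ → Fin K
  F = xiSummand m ω ℓ t

charSummand : ∀ {K L} → (Fin L → Fin K) → ℕ → ℕ
charSummand {L = L} β = argument (λ f → sumℕ f L) (refl {x = charSum β})

charSummand-< : ∀ {K L} (β : Fin L → Fin K) {j} (j<L : j < L) → charSummand β j ≡ toℕ (β (fromℕ< j<L))
charSummand-< {L = L} β {j} j<L with j <? L
... | yes _   = refl
... | no j≮L = ⊥-elim (j≮L j<L)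

-- The Lempel period

module LempelPeriod {K d c : ℕ} .{{_ : NonZero K}} .{{_ : NonZero d}}
                    (K∣dc : K ∣ d * c) (minimal : ∀ d′ → 0 < d′ → K ∣ d′ * c → d ≤ d′) where

  -- K ∣ (K mod d)·c, so minimality of d leaves no room for a nonzero remainder.
  d∣K : d ∣ K
  d∣K with K % d in K%d≡r
  ... | zero  = m%n≡0⇒n∣m K d K%d≡r
  ... | suc r = ⊥-elim (<⇒≱ (subst (_< d) K%d≡r (m%n<n K d)) (minimal (suc r) z<s K∣rc))
    where
    rearrange : ∀ a b e f → (a + b * e) * f ≡ b * (e * f) + a * f
    rearrange = solve-∀

    K∣rc : K ∣ suc r * c
    K∣rc = ∣m+n∣m⇒∣n (subst (K ∣_) decomposition (m∣m*n c)) (∣n⇒∣m*n (K / d) K∣dc)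
      where
      decomposition : K * c ≡ K / d * (d * c) + suc r * c
      decomposition = trans (cong (_* c) (trans (m≡m%n+[m/n]*n K d) (cong (_+ K / d * d) K%d≡r)))
                            (rearrange (suc r) (K / d) d c)

  p : ℕ
  p = K / d

  K≡d*p : K ≡ d * p
  K≡d*p = sym (m*[n/m]≡n d∣K)

  instance
    p-nonZero : NonZero p
    p-nonZero = >-nonZero (m≥n⇒m/n>0 (∣⇒≤ d∣K))

  p∣c : p ∣ c
  p∣c = *-cancelˡ-∣ d (subst (_∣ d * c) K≡d*p K∣dc)

  p∣K : p ∣ K
  p∣K = subst (p ∣_) (sym K≡d*p) (n∣m*n d)

  multiples-injective-≤ : ∀ {q q′} → q ≤ q′ → q′ < d → q * c % K ≡ q′ * c % K → q ≡ q′
  multiples-injective-≤ {q} {q′} q≤q′ q′<d qc≡q′c with m≤n⇒m<n∨m≡n q≤q′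
  ... | inj₂ q≡q′ = q≡q′
  ... | inj₁ q<q′ =
    ⊥-elim (<⇒≱ (≤-<-trans (m∸n≤m q′ q) q′<d) (minimal (q′ ∸ q) (m<n⇒0<n∸m q<q′) K∣[q′∸q]c))
    where
    K∣[q′∸q]c : K ∣ (q′ ∸ q) * c
    K∣[q′∸q]c = subst (K ∣_) (sym (*-distribʳ-∸ c q′ q)) (%≡%⇒∣∸ K qc≡q′c (*-monoˡ-≤ c q≤q′))

  multiples-injective : ∀ {q q′} → q < d → q′ < d → q * c % K ≡ q′ * c % K → q ≡ q′
  multiples-injective {q} {q′} q<d q′<d qc≡q′c with ≤-total q q′
  ... | inj₁ q≤q′ = multiples-injective-≤ q≤q′ q′<d qc≡q′c
  ... | inj₂ q′≤q = sym (multiples-injective-≤ q′≤q q<d (sym qc≡q′c))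

  residue-injective : ∀ P {i i′ q q′} → i < p → i′ < p → q < d → q′ < d →
                      (i + (q * c + P)) % K ≡ (i′ + (q′ * c + P)) % K → i ≡ i′ × q ≡ q′
  residue-injective P {i} {i′} {q} {q′} i<p i′<p q<d q′<d res≡res′ = i≡i′ , q≡q′
    where
    open ≡-Reasoning
    rearrange : ∀ i q → i + (q * c + P) ≡ P + i + q * c
    rearrange i q = trans (cong (i +_) (+-comm (q * c) P)) (trans (sym (+-assoc i P (q * c))) (cong (_+ q * c) (+-comm i P)))

    residue%p : ∀ i q → (i + (q * c + P)) % K % p ≡ (P + i) % p
    residue%p i q = trans (m∣n⇒o%n%m≡o%m p K _ p∣K)
                          (trans (cong (_% p) (rearrange i q)) (%-remove-+ʳ (P + i) (∣n⇒∣m*n q p∣c)))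

    i≡i′ : i ≡ i′
    i≡i′ = begin
      i      ≡⟨ m<n⇒m%n≡m i<p ⟨
      i % p  ≡⟨ %-cancel-+ˡ P i i′ p (trans (sym (residue%p i q)) (trans (cong (_% p) res≡res′) (residue%p i′ q′))) ⟩
      i′ % p ≡⟨ m<n⇒m%n≡m i′<p ⟩
      i′     ∎

    q≡q′ : q ≡ q′
    q≡q′ = multiples-injective q<d q′<d (%-cancel-+ˡ (P + i) (q * c) (q′ * c) K (begin
      (P + i + q * c) % K      ≡⟨ cong (_% K) (rearrange i q) ⟨
      (i + (q * c + P)) % K    ≡⟨ res≡res′ ⟩
      (i′ + (q′ * c + P)) % K  ≡⟨ cong (_% K) (rearrange i′ q′) ⟩
      (P + i′ + q′ * c) % K    ≡⟨ cong (λ j → (P + j + q′ * c) % K) i≡i′ ⟨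
      (P + i + q′ * c) % K     ∎))

  -- Encoding the pair (i, q) as n = q·p + i ∈ [0, K), the residue map becomes injective on
  -- [0, K), so it hits every residue exactly once.
  residues-hit-once : ∀ P ℓ → ℓ < K → sumℕ (λ i → sumℕ (λ q → indicator ((i + (q * c + P)) % K ≡ᵇ ℓ)) d) p ≡ 1
  residues-hit-once P ℓ ℓ<K = begin
    sumℕ (λ i → sumℕ (λ q → hit (residue i q)) d) p
      ≡⟨ sumℕ-comm p d (λ i q → hit (residue i q)) ⟩
    sumℕ (λ q → sumℕ (λ i → hit (residue i q)) p) d
      ≡⟨ sumℕ-cong d (λ q _ → sumℕ-cong p (λ i i<p → cong hit (decode-block q i<p))) ⟨
    sumℕ (λ q → sumℕ (λ i → hit (decode (q * p + i))) p) d
      ≡⟨ sumℕ-* d p (λ n → hit (decode n)) ⟨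
    sumℕ (λ n → hit (decode n)) (d * p)
      ≡⟨ cong (sumℕ (λ n → hit (decode n))) K≡d*p ⟨
    sumℕ (λ n → hit (decode n)) K
      ≡⟨ count≡sumℕ K (λ n → decode n ≡ᵇ ℓ) ⟨
    count K (λ n → decode n ≡ᵇ ℓ)
      ≡⟨ count-injective-hits K decode (λ n _ → m%n<n _ K) decode-injective ℓ ℓ<K ⟩
    1                                                      ∎
    where
    open ≡-Reasoning
    hit : ℕ → ℕ
    hit x = indicator (x ≡ᵇ ℓ)

    residue : ℕ → ℕ → ℕ
    residue i q = (i + (q * c + P)) % K

    decode : ℕ → ℕ
    decode n = residue (n % p) (n / p)

    decode-block : ∀ q {i} → i < p → decode (q * p + i) ≡ residue i q
    decode-block q {i} i<p = cong₂ residue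
      (trans (cong (_% p) (+-comm (q * p) i)) (trans ([m+kn]%n≡m%n i q p) (m<n⇒m%n≡m i<p)))
      (trans (+-distrib-/-∣ˡ i {d = p} (n∣m*n q)) (trans (cong₂ _+_ (m*n/n≡m q p) (m<n⇒m/n≡0 i<p)) (+-identityʳ q)))

    decode-injective : ∀ a b → a < K → b < K → decode a ≡ decode b → a ≡ b
    decode-injective a b a<K b<K decode≡ with residue-injective P (m%n<n a p) (m%n<n b p)
           (m<n*o⇒m/o<n (subst (a <_) K≡d*p a<K)) (m<n*o⇒m/o<n (subst (b <_) K≡d*p b<K)) decode≡
    ... | a%p≡b%p , a/p≡b/p = begin
      a                 ≡⟨ m≡m%n+[m/n]*n a p ⟩
      a % p + a / p * p ≡⟨ cong₂ (λ i q → i + q * p) a%p≡b%p a/p≡b/p ⟩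
      b % p + b / p * p ≡⟨ m≡m%n+[m/n]*n b p ⟨
      b                 ∎

-- Lempel's lift

module Lift {K L : ℕ} .{{_ : NonZero K}} .{{_ : NonZero L}} (β : Fin L → Fin K) where

  digit : ℕ → ℕ
  digit k = toℕ (β [ k ])

  prefix : ℕ → ℕ
  prefix = sumℕ digit

  charSum≡prefix : charSum β ≡ prefix L
  charSum≡prefix = sumℕ-cong L (λ j j<L → trans (charSummand-< β j<L) (cong toℕ (sym ([]-< β j<L))))

  block%L : ∀ q r → (q * L + r) % L ≡ r % L
  block%L q r = trans (cong (_% L) (+-comm (q * L) r)) ([m+kn]%n≡m%n r q L)

  prefix-periodic : ∀ q r → prefix (q * L + r) ≡ q * charSum β + prefix r
  prefix-periodic q r = begin
    prefix (q * L + r)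
      ≡⟨ sumℕ-+ (q * L) r digit ⟩
    prefix (q * L) + sumℕ (λ k → digit (q * L + k)) r
      ≡⟨ cong (prefix (q * L) +_) (sumℕ-cong r (λ k _ → digit-periodic q k)) ⟩
    prefix (q * L) + prefix r
      ≡⟨ cong (_+ prefix r) (sumℕ-* q L digit) ⟩
    sumℕ (λ i → sumℕ (λ k → digit (i * L + k)) L) q + prefix r
      ≡⟨ cong (_+ prefix r) (sumℕ-cong q (λ i _ → sumℕ-cong L (λ k _ → digit-periodic i k))) ⟩
    sumℕ (λ _ → prefix L) q + prefix r
      ≡⟨ cong (_+ prefix r) (sumℕ-const q (prefix L)) ⟩
    q * prefix L + prefix r
      ≡⟨ cong (λ c → q * c + prefix r) charSum≡prefix ⟨
    q * charSum β + prefix r                                   ∎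
    where
    open ≡-Reasoning
    digit-periodic : ∀ q k → digit (q * L + k) ≡ digit k
    digit-periodic q k = cong toℕ ([]-cong-% β (block%L q k))

  module _ (d : ℕ) .{{_ : NonZero d}} (K∣dc : K ∣ d * charSum β) where

    instance
      dL-nonZero : NonZero (d * L)
      dL-nonZero = m*n≢0 d L

    member : ℕ → Fin (d * L) → Fin K
    member i j = liftMember β (fromℕ< (m%n<n i K)) (toℕ j)

    liftOccurrences≡sumℕ : ∀ m ξ →
      liftOccurrences β d m ξ ≡ sumℕ (λ i → count (d * L) (occursAt (member i) m ξ)) (K / d)
    -- The recursion in liftOccurrences is local to it; after abstracting K / d, unification
    -- can read it off its unfolding.
    liftOccurrences≡sumℕ m ξ with sumℕ-recursion refl (λ _ → refl)
    ... | unfold with K / d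
    ...   | n = unfold n

    prefix-%-periodic : ∀ q r → prefix (q * (d * L) + r) % K ≡ prefix r % K
    prefix-%-periodic q r = begin
      prefix (q * (d * L) + r) % K       ≡⟨ cong (λ n → prefix (n + r) % K) (*-assoc q d L) ⟨
      prefix (q * d * L + r) % K         ≡⟨ cong (_% K) (prefix-periodic (q * d) r) ⟩
      (q * d * charSum β + prefix r) % K ≡⟨ %-remove-+ˡ (prefix r) K∣qdc ⟩
      prefix r % K                       ∎
      where
      open ≡-Reasoning
      K∣qdc : K ∣ q * d * charSum β
      K∣qdc = subst (K ∣_) (sym (*-assoc q d (charSum β))) (∣n⇒∣m*n q K∣dc)

    toℕ-member : ∀ {i} → i < K → ∀ x → toℕ (member i [ x ]) ≡ (i + prefix (suc x)) % K
    toℕ-member {i} i<K x = begin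
      toℕ (member i [ x ])
        ≡⟨ toℕ-⊕ (fromℕ< (m%n<n i K)) _ ⟩
      (toℕ (fromℕ< (m%n<n i K)) + toℕ (sumMod (β [_]) (suc y))) % K
        ≡⟨ cong₂ (λ a b → (a + b) % K) (trans (toℕ-fromℕ< _) (m<n⇒m%n≡m i<K)) (toℕ-sumMod (β [_]) (suc y)) ⟩
      (i + prefix (suc y) % K) % K
        ≡⟨ cong (λ z → (i + prefix (suc z) % K) % K) (toℕ-fromℕ< _) ⟩
      (i + prefix (suc (x % (d * L))) % K) % K
        ≡⟨ cong (λ z → (i + z) % K) (prefix-%-periodic (x / (d * L)) _) ⟨
      (i + prefix (x / (d * L) * (d * L) + suc (x % (d * L))) % K) % K
        ≡⟨ cong (λ z → (i + prefix z % K) % K) period-split ⟩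
      (i + prefix (suc x) % K) % K
        ≡⟨ [m+o%n]%n≡[m+o]%n i (prefix (suc x)) K ⟩
      (i + prefix (suc x)) % K                                   ∎
      where
      open ≡-Reasoning
      y : ℕ
      y = toℕ (fromℕ< (m%n<n x (d * L)))
      period-split : x / (d * L) * (d * L) + suc (x % (d * L)) ≡ suc x
      period-split = trans (+-suc _ _) (cong suc (trans (+-comm _ (x % (d * L))) (sym (m≡m%n+[m/n]*n x (d * L)))))

    module _ {m : ℕ} (ω : Fin m → Fin K) (ℓ : Fin K) where

      startsAt : ℕ → ℕ → Bool
      startsAt i z = (i + prefix z) % K ≡ᵇ toℕ ℓ

      occursAt-digits⇔ : ∀ r → T (occursAt β m ω r) ⇔ (∀ u → u < m → digit (r + u) ≡ stringDigit ω u)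
      occursAt-digits⇔ r = ⇔-trans (occursAt⇔ β m ω r) (mk⇔
        (λ h u u<m → trans (cong toℕ (h u u<m)) (sym (stringDigit-< ω u<m)))
        (λ h u u<m → toℕ-injective (trans (h u u<m) (stringDigit-< ω u<m))))

      member-occursAt : ∀ {i} → i < K → ∀ s →
                        occursAt (member i) (suc m) (xiString m ω ℓ) s ≡ (startsAt i (suc s) ∧ occursAt β m ω (suc s))
      member-occursAt {i} i<K s = T⇔T⇒≡ (⇔-trans (occursAt⇔ (member i) (suc m) (xiString m ω ℓ) s)
        (⇔-trans as-congruences
        (⇔-trans (running-sums-≡-mod⇔ a (toℕ ℓ) x (stringDigit ω) m (λ _ → toℕ<n _) (stringDigit<K ω))
                 (⇔-sym (⇔-trans T-∧ (start⇔ ×-⇔ occursAt-digits⇔ (suc s)))))))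
        where
        a : ℕ
        a = i + prefix (suc s)
        x : ℕ → ℕ
        x k = digit (suc s + k)

        member-value : ∀ u → toℕ (member i [ s + u ]) ≡ (a + sumℕ x u) % K
        member-value u = trans (toℕ-member i<K (s + u))
          (cong (_% K) (trans (cong (i +_) (sumℕ-+ (suc s) u digit)) (sym (+-assoc i (prefix (suc s)) (sumℕ x u)))))

        ξ-value : ∀ {u} (u<1+m : u < suc m) → toℕ (xiString m ω ℓ (fromℕ< u<1+m)) ≡ (toℕ ℓ + sumℕ (stringDigit ω) u) % K
        ξ-value u<1+m = trans (toℕ-xiString m ω ℓ (fromℕ< u<1+m))
                              (cong (λ u → (toℕ ℓ + sumℕ (stringDigit ω) u) % K) (toℕ-fromℕ< u<1+m))

        as-congruences : (∀ u (u<1+m : u < suc m) → member i [ s + u ] ≡ xiString m ω ℓ (fromℕ< u<1+m)) ⇔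
                         (∀ u → u ≤ m → (a + sumℕ x u) % K ≡ (toℕ ℓ + sumℕ (stringDigit ω) u) % K)
        as-congruences = mk⇔
          (λ h u u≤m → trans (sym (member-value u)) (trans (cong toℕ (h u (s≤s u≤m))) (ξ-value (s≤s u≤m))))
          (λ h u u<1+m → toℕ-injective (trans (member-value u) (trans (h u (s≤s⁻¹ u<1+m)) (sym (ξ-value u<1+m)))))

        start⇔ : T (startsAt i (suc s)) ⇔ (a % K ≡ toℕ ℓ % K)
        start⇔ = mk⇔ (λ h → trans (≡ᵇ⇒≡ _ _ h) (sym ℓ%K)) (λ h → ≡⇒≡ᵇ _ _ (trans h ℓ%K))
          where
          ℓ%K : toℕ ℓ % K ≡ toℕ ℓ
          ℓ%K = m<n⇒m%n≡m (toℕ<n ℓ)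

      liftOccurrences≡occurrences : (∀ d′ → 0 < d′ → K ∣ d′ * charSum β → d ≤ d′) →
                                    liftOccurrences β d (suc m) (xiString m ω ℓ) ≡ occurrences β m ω
      liftOccurrences≡occurrences minimal = begin
        liftOccurrences β d (suc m) (xiString m ω ℓ)
          ≡⟨ liftOccurrences≡sumℕ (suc m) (xiString m ω ℓ) ⟩
        sumℕ (λ i → count (d * L) (occursAt (member i) (suc m) (xiString m ω ℓ))) p
          ≡⟨ sumℕ-cong p (λ i i<p → trans (count≡sumℕ (d * L) _)
               (sumℕ-cong (d * L) (λ s _ → cong indicator (member-occursAt (<-≤-trans i<p (m/n≤m K d)) s)))) ⟩
        sumℕ (λ i → sumℕ (λ s → indicator (match i (suc s))) (d * L)) p
          ≡⟨ sumℕ-cong p (λ i _ → sumℕ-rotate (d * L) (λ z → indicator (match i z)) (match-periodic i)) ⟩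
        sumℕ (λ i → sumℕ (λ z → indicator (match i z)) (d * L)) p
          ≡⟨ sumℕ-cong p (λ i _ → sumℕ-* d L (λ z → indicator (match i z))) ⟩
        sumℕ (λ i → sumℕ (λ q → sumℕ (λ r → indicator (match i (q * L + r))) L) d) p
          ≡⟨ sumℕ-cong p (λ i _ → sumℕ-cong d (λ q _ → sumℕ-cong L (λ r _ → match-block i q r))) ⟩
        sumℕ (λ i → sumℕ (λ q → sumℕ (λ r → indicator (occursAt β m ω r) * residueHit i q r) L) d) p
          ≡⟨ sumℕ-factor p d L (λ r → indicator (occursAt β m ω r)) residueHit ⟩
        sumℕ (λ r → indicator (occursAt β m ω r) * sumℕ (λ i → sumℕ (λ q → residueHit i q r) d) p) L
          ≡⟨ sumℕ-cong L (λ r _ → trans (cong (indicator (occursAt β m ω r) *_)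
                                              (residues-hit-once (prefix r) (toℕ ℓ) (toℕ<n ℓ)))
                                        (*-identityʳ _)) ⟩
        sumℕ (λ r → indicator (occursAt β m ω r)) L
          ≡⟨ count≡sumℕ L (occursAt β m ω) ⟨
        occurrences β m ω
          ∎
        where
        open ≡-Reasoning
        open LempelPeriod K∣dc minimal

        match : ℕ → ℕ → Bool
        match i z = startsAt i z ∧ occursAt β m ω z

        residueHit : ℕ → ℕ → ℕ → ℕ
        residueHit i q r = indicator ((i + (q * charSum β + prefix r)) % K ≡ᵇ toℕ ℓ)

        match-block : ∀ i q r → indicator (match i (q * L + r)) ≡ indicator (occursAt β m ω r) * residueHit i q r
        match-block i q r = trans (indicator-∧ (startsAt i (q * L + r)) _) (trans (cong₂ _*_
          (cong (λ n → indicator ((i + n) % K ≡ᵇ toℕ ℓ)) (prefix-periodic q r))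
          (cong indicator (occursAt-cong-% β m ω (block%L q r)))) (*-comm (residueHit i q r) _))

        match-periodic : ∀ i → indicator (match i (d * L)) ≡ indicator (match i 0)
        match-periodic i = cong indicator (cong₂ _∧_
          (cong (_≡ᵇ toℕ ℓ) (%-cong-+ˡ i (prefix (d * L)) 0 K
            (trans (cong (λ n → prefix n % K) (sym (trans (+-identityʳ (1 * (d * L))) (*-identityˡ (d * L)))))
                   (prefix-%-periodic 1 0))))
          (occursAt-cong-% β m ω (trans (cong (_% L) (sym (+-identityʳ (d * L)))) (block%L d 0))))

lemma1 : (K : ℕ) → K ≥ 2 → .{{_ : NonZero K}} →
    (L : ℕ) .{{_ : NonZero L}} → (β : Fin L → Fin K) →
    (d : ℕ) .{{_ : NonZero d}} → IsLempelPeriod β d →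
    (m : ℕ) → m < L → (ω : Fin m → Fin K) →
    (ℓ : Fin K) → (t : ℕ) →
    (occurrences β m ω ≡ t) ⇔ (liftOccurrences β d (suc m) (xiString m ω ℓ) ≡ t)
lemma1 K _ L β d (_ , K∣dc , minimal) m _ ω ℓ t = mk⇔ (trans counts-agree) (trans (sym counts-agree))
  where
  counts-agree : liftOccurrences β d (suc m) (xiString m ω ℓ) ≡ occurrences β m ω
  counts-agree = Lift.liftOccurrences≡occurrences β d K∣dc ω ℓ minimal
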